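{- Let $n\ge1$ and let $\mathcal M_1,\dots,\mathcal M_f$ be finitely many minions such that each $\mathcal M_i$ is $(n,k_i)$-representable. Then the sum $\sum_i\mathcal M_i$ is $(n,\sum_i k_i)$-representable.
   Context: Write $n=\{0,\dots,n-1\}$. A minion $\mathcal M$ consists of sets $\mathcal M_l$ ($l\ge1$) and maps $f\mapsto f\alpha$ for each map $\alpha:l\to m$, with $f\,\mathrm{id}=f$, $(f\alpha)\beta=f(\beta\circ\alpha)$. The sum $\sum_i\mathcal M_i$ has arity-$l$ set the disjoint union $\coprod_i(\mathcal M_i)_l$ with minor maps acting within each summand. $\mathcal O(n,k)_l$ is the set of functions $n^l\to k$ with $(f\alpha)(x_0,\dots,x_{m-1})=f(x_{\alpha(0)},\dots,x_{\alpha(l-1)})$. A minion is $(n,k)$-representable if there is an arity-wise injective family of maps into $\mathcal O(n,k)$ commuting with the minor maps. -}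

module Defs where

open import Level using (Level; _⊔_; suc)
open import Data.Nat using (ℕ; _+_) renaming (suc to sucℕ)
open import Data.Fin using (Fin)
open import Data.Product using (Σ; _,_; proj₁; proj₂; ∃)
open import Function using (_∘_; id)
open import Relation.Binary.PropositionalEquality using (_≡_)

-- Convention: arities l ≥ 1 are encoded as  sucℕ l  for l : ℕ,
-- and the set  l = {0,…,l-1}  is  Fin l.

record Minion (a : Level) : Set (Level.suc a) where
  field
    M     : ℕ → Set a
    minor : ∀ {l m} → M l → (Fin (sucℕ l) → Fin (sucℕ m)) → M m
    minor-id   : ∀ {l} (f : M l) → minor f id ≡ f
    minor-comp : ∀ {l m p} (f : M l) (α : Fin (sucℕ l) → Fin (sucℕ m))
                   (β : Fin (sucℕ m) → Fin (sucℕ p)) →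
                   minor (minor f α) β ≡ minor f (β ∘ α)

open Minion public

SumMinion : ∀ {a} {r : ℕ} → (Fin r → Minion a) → Minion a
SumMinion {r = r} Ms = record
  { M = λ l → Σ (Fin r) (λ i → M (Ms i) l)
  ; minor = λ { (i , f) α → i , minor (Ms i) f α }
  ; minor-id = λ { (i , f) → cong-pair i (minor-id (Ms i) f) }
  ; minor-comp = λ { (i , f) α β → cong-pair i (minor-comp (Ms i) f α β) }
  }
  where
  open import Relation.Binary.PropositionalEquality using (cong)
  cong-pair : ∀ {l} i {x y : M (Ms i) l} → x ≡ y → _≡_ {A = Σ (Fin r) (λ j → M (Ms j) l)} (i , x) (i , y)
  cong-pair i p = cong (i ,_) p

O : ℕ → ℕ → ℕ → Set
O n k l = (Fin (sucℕ l) → Fin n) → Fin k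

_≈O_ : ∀ {n k l} → O n k l → O n k l → Set
g ≈O h = ∀ x → g x ≡ h x

minorO : ∀ {n k l m} → O n k l → (Fin (sucℕ l) → Fin (sucℕ m)) → O n k m
minorO g α x = g (x ∘ α)

Representable : ∀ {a} → ℕ → ℕ → Minion a → Set a
Representable n k 𝓜 =
  Σ (∀ l → M 𝓜 l → O n k l) λ ι →
    (∀ l (f g : M 𝓜 l) → ι l f ≈O ι l g → f ≡ g)
    Data.Product.× (∀ l m (f : M 𝓜 l) (α : Fin (sucℕ l) → Fin (sucℕ m)) →
         ι m (minor 𝓜 f α) ≈O minorO (ι l f) α)

∑ : ∀ {r} → (Fin r → ℕ) → ℕ
∑ {ℕ.zero} k = 0
∑ {sucℕ r} k = k Fin.zero + ∑ (k ∘ Fin.suc)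

{-# OPTIONS --safe #-}
-- Fin (∑ k) is the disjoint union of the Fin (k i), so the representations of
-- the summands can be combined by sending an element f of the i-th summand to
-- the function x ↦ (i, ιᵢ f x). This is injective because n ≥ 1: a constant
-- tuple exists, and the first coordinate of the value there recovers i.
module Submission where

open import Defs
open import Level using (Level)
open import Data.Nat using (ℕ; _≥_; s≤s)
open import Data.Fin using (Fin; zero; suc; _↑ˡ_; _↑ʳ_; splitAt; _≟_)
open import Data.Fin.Properties using (splitAt-↑ˡ; splitAt-↑ʳ)
open import Data.Product using (Σ; _,_; proj₁; proj₂; map)
open import Data.Product.Properties using (,-injectiveˡ; ,-injectiveʳ-UIP)
open import Data.Sum using ([_,_]′)
open import Function using (_∘_; id; const; _∋_)
open import Function.Definitions using (Injective)
open import Axiom.UniquenessOfIdentityProofs using (module Decidable⇒UIP)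
open import Relation.Binary.PropositionalEquality using (_≡_; refl; sym; cong; module ≡-Reasoning)

∑-join : ∀ {r} (k : Fin r → ℕ) → Σ (Fin r) (Fin ∘ k) → Fin (∑ k)
∑-join k (zero  , y) = y ↑ˡ ∑ (k ∘ suc)
∑-join k (suc i , y) = k zero ↑ʳ ∑-join (k ∘ suc) (i , y)

∑-split : ∀ {r} (k : Fin r → ℕ) → Fin (∑ k) → Σ (Fin r) (Fin ∘ k)
∑-split {ℕ.suc r} k = [ zero ,_ , map suc id ∘ ∑-split (k ∘ suc) ]′ ∘ splitAt (k zero)

∑-split-join : ∀ {r} (k : Fin r → ℕ) p → ∑-split k (∑-join k p) ≡ p
∑-split-join k (zero , y) rewrite splitAt-↑ˡ (k zero) y (∑ (k ∘ suc)) = refl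
∑-split-join k (suc i , y)
  rewrite splitAt-↑ʳ (k zero) (∑ (k ∘ suc)) (∑-join (k ∘ suc) (i , y))
        | ∑-split-join (k ∘ suc) (i , y) = refl

∑-join-injective : ∀ {r} (k : Fin r → ℕ) → Injective _≡_ _≡_ (∑-join k)
∑-join-injective k {p} {q} eq = begin
  p                        ≡⟨ sym (∑-split-join k p) ⟩
  ∑-split k (∑-join k p)   ≡⟨ cong (∑-split k) eq ⟩
  ∑-split k (∑-join k q)   ≡⟨ ∑-split-join k q ⟩
  q                        ∎
  where open ≡-Reasoning

module _ {a} {n r} {Ms : Fin r → Minion a} {k : Fin r → ℕ}
         (R : ∀ i → Representable n (k i) (Ms i)) where

  private
    ι : ∀ i l → M (Ms i) l → O n (k i) l
    ι i = proj₁ (R i)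

    ι-injective : ∀ i l (f g : M (Ms i) l) → ι i l f ≈O ι i l g → f ≡ g
    ι-injective i = proj₁ (proj₂ (R i))

    ι-minor : ∀ i l m (f : M (Ms i) l) (α : Fin (ℕ.suc l) → Fin (ℕ.suc m)) →
              ι i m (minor (Ms i) f α) ≈O minorO (ι i l f) α
    ι-minor i = proj₂ (proj₂ (R i))

  Representable-sum : Fin n → Representable n (∑ k) (SumMinion Ms)
  Representable-sum c = ιΣ , ιΣ-injective , ιΣ-minor
    where
    ιΣ : ∀ l → M (SumMinion Ms) l → O n (∑ k) l
    ιΣ l (i , f) x = ∑-join k (i , ι i l f x)

    tagged-values-eq : ∀ l {i j} (f : M (Ms i) l) (g : M (Ms j) l) → ιΣ l (i , f) ≈O ιΣ l (j , g) →
                       ∀ x → (Σ (Fin r) (Fin ∘ k) ∋ (i , ι i l f x)) ≡ (j , ι j l g x)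
    tagged-values-eq l f g eq x = ∑-join-injective k (eq x)

    ιΣ-injective : ∀ l (f g : M (SumMinion Ms) l) → ιΣ l f ≈O ιΣ l g → f ≡ g
    ιΣ-injective l (i , f) (j , g) eq with ,-injectiveˡ (tagged-values-eq l f g eq (const c))
    ... | refl = cong (i ,_) (ι-injective i l f g λ x →
                   ,-injectiveʳ-UIP (Decidable⇒UIP.≡-irrelevant _≟_) (tagged-values-eq l f g eq x))

    ιΣ-minor : ∀ l m (f : M (SumMinion Ms) l) (α : Fin (ℕ.suc l) → Fin (ℕ.suc m)) →
               ιΣ m (minor (SumMinion Ms) f α) ≈O minorO (ιΣ l f) α
    ιΣ-minor l m (i , f) α x = cong (∑-join k ∘ (i ,_)) (ι-minor i l m f α x)

proposition5p2p1 : ∀ {a : Level} (n : ℕ) → n ≥ 1 → (r : ℕ) (Ms : Fin r → Minion a) (k : Fin r → ℕ) →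
    (∀ i → Representable n (k i) (Ms i)) → Representable n (∑ k) (SumMinion Ms)
proposition5p2p1 (ℕ.suc n) (s≤s _) r Ms k R = Representable-sum {Ms = Ms} {k = k} R zero
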